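{- Let $\mathbf{U}=(\mathbf{T},G,H)$ be an $\mathrm{itKI}_{c1}$-algebra. Then the lattice of centered tense deductive systems of $\mathbf{U}$ is isomorphic to the lattice $\mathsf{Con}(\mathbf{U})$ of congruences of $\mathbf{U}$.
   Context: A centered Kleene algebra is $\langle T,\wedge,\vee,\sim,c,0,1\rangle$ with bounded distributive lattice reduct, $\sim\sim x=x$, $\sim(x\vee y)=\sim x\wedge\sim y$, $x\wedge\sim x\le y\vee\sim y$, $\sim c=c$. A KI-algebra is $\langle T,\wedge,\vee,\Rightarrow,\sim,c,0,1\rangle$ with centered Kleene reduct such that: $(a\Rightarrow b)\wedge(a\Rightarrow d)=a\Rightarrow(b\wedge d)$, $(a\Rightarrow d)\wedge(b\Rightarrow d)=(a\vee b)\Rightarrow d$, $0\Rightarrow a=1$, $a\Rightarrow 1=1$; $(x\wedge(x\Rightarrow y))\vee c\le y\vee c$; $c\Rightarrow c=1$; $(x\Rightarrow y)\wedge c=(\sim x\vee y)\wedge c$; $(x\Rightarrow\sim y)\vee c=(x\Rightarrow(\sim y\vee c))\wedge(y\Rightarrow(\sim x\vee c))$. A tense centered KI-algebra is $(\mathbf{T},G,H)$ with $F(x):=\sim G(\sim x)$, $P(x):=\sim H(\sim x)$ satisfying $G(1)=H(1)=1$; $G,H$ preserve $\wedge$; $x\le GP(x)$, $x\le HF(x)$; $G(x\vee y)\le G(x)\vee F(y)$, $H(x\vee y)\le H(x)\vee P(y)$; $G(x\Rightarrow y)\le G(x)\Rightarrow G(y)$, $H(x\Rightarrow y)\le H(x)\Rightarrow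 H(y)$; $G(x\Rightarrow y)\le F(x)\Rightarrow F(y)$, $H(x\Rightarrow y)\le P(x)\Rightarrow P(y)$; $G(c)=c=H(c)$. An $\mathrm{itKI}_{c1}$-algebra is a tense centered KI-algebra satisfying $x\Rightarrow x=1$ and (CK): for all $x,y\ge c$ with $x\wedge y\le c$ there is $z$ with $z\vee c=x$ and $\sim z\vee c=y$. $C(T)=\{x\in T:x\ge c\}$ with restricted operations. A tense 1-filter of $C(T)$ is a lattice filter $S$ of $C(T)$ with $((a\wedge f)\Rightarrow b)\Rightarrow(a\Rightarrow b)\in S$ for all $a,b\in C(T)$, $f\in S$, closed under $G,H$. A tense deductive system of $\mathbf{U}$ is $D\subseteq T$ with $1\in D$; $u,u\Rightarrow v\in D$ implies $v\in D$; $u\in D$ implies $G(u),H(u)\in D$. It is centered if $D\cap C(T)$ is a tense 1-filter of $C(T)$ and for every $u\in T$, $\sim u\Rightarrow c\in D$ and $1\Rightarrow(u\vee c)\in D$ imply $u\in D$. Congruences are compatible with $\wedge,\vee,\Rightarrow,\sim,c,0,1,G,H$. -}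

module Defs where

open import Level using (Level; suc; _⊔_)
open import Relation.Binary.PropositionalEquality using (_≡_)
open import Relation.Binary.Structures using (IsEquivalence)
open import Relation.Binary.Core using (Rel)
open import Relation.Unary using (Pred; _⊆_; _∈_)
open import Data.Product using (Σ; _×_; _,_)
import Algebra.Lattice.Structures as LS

record TenseCenteredKI (a : Level) : Set (suc a) where
  field
    Carrier : Set a
    _∧_ _∨_ _⇒_ : Carrier → Carrier → Carrier
    ∼ : Carrier → Carrier
    c 𝟎 𝟏 : Carrier
    G H : Carrier → Carrier

  infixr 8 _∧_
  infixr 7 _∨_
  infixr 6 _⇒_
  infix 4 _≤_

  _≤_ : Carrier → Carrier → Set a
  x ≤ y = x ∧ y ≡ x

  F : Carrier → Carrier
  F x = ∼ (G (∼ x))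

  P : Carrier → Carrier
  P x = ∼ (H (∼ x))

  field
    isDistributiveLattice : LS.IsDistributiveLattice _≡_ _∨_ _∧_
    ∨-identity-𝟎 : ∀ x → x ∨ 𝟎 ≡ x
    ∧-identity-𝟏 : ∀ x → x ∧ 𝟏 ≡ x
    ∼-involutive : ∀ x → ∼ (∼ x) ≡ x
    ∼-deMorgan : ∀ x y → ∼ (x ∨ y) ≡ ∼ x ∧ ∼ y
    kleene : ∀ x y → (x ∧ ∼ x) ≤ (y ∨ ∼ y)
    ∼c : ∼ c ≡ c
    ⇒-∧ : ∀ a b d → (a ⇒ b) ∧ (a ⇒ d) ≡ a ⇒ (b ∧ d)
    ⇒-∨ : ∀ a b d → (a ⇒ d) ∧ (b ⇒ d) ≡ (a ∨ b) ⇒ d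
    𝟎⇒ : ∀ a → 𝟎 ⇒ a ≡ 𝟏
    ⇒𝟏 : ∀ a → a ⇒ 𝟏 ≡ 𝟏
    mp-c : ∀ x y → (x ∧ (x ⇒ y)) ∨ c ≤ y ∨ c
    c⇒c : c ⇒ c ≡ 𝟏
    ⇒-c : ∀ x y → (x ⇒ y) ∧ c ≡ (∼ x ∨ y) ∧ c
    ⇒-∼ : ∀ x y → (x ⇒ ∼ y) ∨ c ≡ (x ⇒ (∼ y ∨ c)) ∧ (y ⇒ (∼ x ∨ c))
    G𝟏 : G 𝟏 ≡ 𝟏
    H𝟏 : H 𝟏 ≡ 𝟏
    G-∧ : ∀ x y → G (x ∧ y) ≡ G x ∧ G y
    H-∧ : ∀ x y → H (x ∧ y) ≡ H x ∧ H y
    x≤GPx : ∀ x → x ≤ G (P x)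
    x≤HFx : ∀ x → x ≤ H (F x)
    G-∨ : ∀ x y → G (x ∨ y) ≤ G x ∨ F y
    H-∨ : ∀ x y → H (x ∨ y) ≤ H x ∨ P y
    G-⇒ : ∀ x y → G (x ⇒ y) ≤ (G x ⇒ G y)
    H-⇒ : ∀ x y → H (x ⇒ y) ≤ (H x ⇒ H y)
    G-⇒F : ∀ x y → G (x ⇒ y) ≤ (F x ⇒ F y)
    H-⇒P : ∀ x y → H (x ⇒ y) ≤ (P x ⇒ P y)
    Gc : G c ≡ c
    Hc : H c ≡ c

record ItKIc1 (a : Level) : Set (suc a) where
  field
    tkI : TenseCenteredKI a
  open TenseCenteredKI tkI public
  field
    ⇒-refl : ∀ x → x ⇒ x ≡ 𝟏
    CK : ∀ x y → c ≤ x → c ≤ y → (x ∧ y) ≤ c →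
         Σ Carrier (λ z → (z ∨ c ≡ x) × (∼ z ∨ c ≡ y))

module _ {a : Level} (U : ItKIc1 a) where
  open ItKIc1 U

  C : Pred Carrier a
  C x = c ≤ x

  record IsTense1Filter {ℓ : Level} (S : Pred Carrier ℓ) : Set (a ⊔ ℓ) where
    field
      ⊆C : S ⊆ C
      𝟏∈ : 𝟏 ∈ S
      up : ∀ {x y} → x ∈ S → y ∈ C → x ≤ y → y ∈ S
      ∧-closed : ∀ {x y} → x ∈ S → y ∈ S → (x ∧ y) ∈ S
      one : ∀ {a b f} → a ∈ C → b ∈ C → f ∈ S → (((a ∧ f) ⇒ b) ⇒ (a ⇒ b)) ∈ S
      G-closed : ∀ {x} → x ∈ S → G x ∈ S
      H-closed : ∀ {x} → x ∈ S → H x ∈ S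

  record IsTenseDS {ℓ : Level} (D : Pred Carrier ℓ) : Set (a ⊔ ℓ) where
    field
      𝟏∈ : 𝟏 ∈ D
      mp : ∀ {u v} → u ∈ D → (u ⇒ v) ∈ D → v ∈ D
      G-closed : ∀ {u} → u ∈ D → G u ∈ D
      H-closed : ∀ {u} → u ∈ D → H u ∈ D

  record IsCenteredTenseDS {ℓ : Level} (D : Pred Carrier ℓ) : Set (a ⊔ ℓ) where
    field
      isTenseDS : IsTenseDS D
      filter : IsTense1Filter (λ x → x ∈ D × x ∈ C)
      centered : ∀ u → (∼ u ⇒ c) ∈ D → (𝟏 ⇒ (u ∨ c)) ∈ D → u ∈ D

  record IsCongruence {ℓ : Level} (θ : Rel Carrier ℓ) : Set (a ⊔ ℓ) where
    field
      isEquivalence : IsEquivalence θ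
      ∧-cong : ∀ {x x′ y y′} → θ x x′ → θ y y′ → θ (x ∧ y) (x′ ∧ y′)
      ∨-cong : ∀ {x x′ y y′} → θ x x′ → θ y y′ → θ (x ∨ y) (x′ ∨ y′)
      ⇒-cong : ∀ {x x′ y y′} → θ x x′ → θ y y′ → θ (x ⇒ y) (x′ ⇒ y′)
      ∼-cong : ∀ {x x′} → θ x x′ → θ (∼ x) (∼ x′)
      G-cong : ∀ {x x′} → θ x x′ → θ (G x) (G x′)
      H-cong : ∀ {x x′} → θ x x′ → θ (H x) (H x′)

  CDS : (ℓ : Level) → Set (a ⊔ suc ℓ)
  CDS ℓ = Σ (Pred Carrier ℓ) IsCenteredTenseDS

  Con : (ℓ : Level) → Set (a ⊔ suc ℓ)
  Con ℓ = Σ (Rel Carrier ℓ) IsCongruence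

  _⊑D_ : ∀ {ℓ} → CDS ℓ → CDS ℓ → Set (a ⊔ ℓ)
  (D , _) ⊑D (E , _) = D ⊆ E

  _⊑C_ : ∀ {ℓ} → Con ℓ → Con ℓ → Set (a ⊔ ℓ)
  (θ , _) ⊑C (φ , _) = ∀ {x y} → θ x y → φ x y

  -- Order isomorphism between the two inclusion-ordered posets
  -- (elements compared up to extensional equality = mutual inclusion).
  -- An order isomorphism of lattices is a lattice isomorphism.
  record CDS≅Con (ℓ : Level) : Set (a ⊔ suc ℓ) where
    field
      to : CDS ℓ → Con ℓ
      from : Con ℓ → CDS ℓ
      to-mono : ∀ {D E} → D ⊑D E → to D ⊑C to E
      from-mono : ∀ {θ φ} → θ ⊑C φ → from θ ⊑D from φ
      from∘to : ∀ D → (from (to D) ⊑D D) × (D ⊑D from (to D))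
      to∘from : ∀ θ → (to (from θ) ⊑C θ) × (θ ⊑C to (from θ))

module Submission where

open import Defs
open import Level using (Level)
open import Algebra.Core using (Op₂)
open import Algebra.Lattice.Bundles using (Lattice)
open import Algebra.Lattice.Structures using (IsLattice)
import Algebra.Lattice.Structures as LS
import Algebra.Lattice.Properties.Lattice as LatticeProperties
import Relation.Binary.Lattice.Bundles as OrderTheoretic
import Relation.Binary.Lattice.Properties.JoinSemilattice as JoinSemilatticeProperties
import Relation.Binary.Lattice.Properties.MeetSemilattice as MeetSemilatticeProperties
open import Relation.Binary.Bundles using (Setoid)
import Relation.Binary.Reasoning.Setoid as SetoidReasoning
open import Relation.Binary.Core using (Rel)
open import Relation.Binary.Structures using (IsEquivalence)
open import Relation.Binary.PropositionalEquality using (_≡_; sym; trans; cong; cong₂; subst; subst₂; module ≡-Reasoning)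
open import Relation.Unary using (Pred; _⊆_; _∈_)
open import Data.Product using (_×_; _,_; proj₁; proj₂)

-- The map x ↦ (x ⁺ , x ⁻) = (x ∨ c , ∼ x ∨ c) embeds T into pairs of elements of
-- C(T), and every operation of T is computed from these pairs by operations of C(T).
-- For a centered deductive system D, the 1-filter condition on D ∩ C(T) makes
-- D-interderivability a congruence of C(T); comparing both components gives a
-- congruence θ_D of T, whose class of 𝟏 is D by the centering condition. Conversely,
-- the class of 𝟏 of a congruence θ is a centered deductive system, and two elements
-- are θ-related iff their components are, i.e. iff the components imply each other
-- modulo θ.

module LatticeOrder {a} {A : Set a} {_∨_ _∧_ : Op₂ A} (isLattice : IsLattice _≡_ _∨_ _∧_) where
  private
    L : Lattice a a
    L = record { isLattice = isLattice }
    open LatticeProperties L using (∨-∧-orderTheoreticLattice)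
    module O = OrderTheoretic.Lattice ∨-∧-orderTheoreticLattice
    open JoinSemilatticeProperties O.joinSemilattice using (∨-monotonic; x≤y⇒x∨y≈y)
    open MeetSemilatticeProperties O.meetSemilattice using (∧-monotonic)

  open LatticeProperties L public using (∨-idem)

  -- The order of TenseCenteredKI; the library's order on a lattice is x ≡ x ∧ y.
  infix 4 _≤_
  _≤_ : Rel A a
  x ≤ y = x ∧ y ≡ x

  ≤-refl : ∀ {x} → x ≤ x
  ≤-refl = sym O.refl

  ≤-reflexive : ∀ {x y} → x ≡ y → x ≤ y
  ≤-reflexive p = sym (O.reflexive p)

  ≤-trans : ∀ {x y z} → x ≤ y → y ≤ z → x ≤ z
  ≤-trans p q = sym (O.trans (sym p) (sym q))

  ≤-antisym : ∀ {x y} → x ≤ y → y ≤ x → x ≡ y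
  ≤-antisym p q = O.antisym (sym p) (sym q)

  x∧y≤x : ∀ x y → x ∧ y ≤ x
  x∧y≤x x y = sym (O.x∧y≤x x y)

  x∧y≤y : ∀ x y → x ∧ y ≤ y
  x∧y≤y x y = sym (O.x∧y≤y x y)

  ∧-greatest : ∀ {x y z} → x ≤ y → x ≤ z → x ≤ y ∧ z
  ∧-greatest p q = sym (O.∧-greatest (sym p) (sym q))

  x≤x∨y : ∀ x y → x ≤ x ∨ y
  x≤x∨y x y = sym (O.x≤x∨y x y)

  y≤x∨y : ∀ x y → y ≤ x ∨ y
  y≤x∨y x y = sym (O.y≤x∨y x y)

  ∨-least : ∀ {x y z} → x ≤ z → y ≤ z → x ∨ y ≤ z
  ∨-least p q = sym (O.∨-least (sym p) (sym q))

  ∧-mono-≤ : ∀ {x x′ y y′} → x ≤ x′ → y ≤ y′ → x ∧ y ≤ x′ ∧ y′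
  ∧-mono-≤ p q = sym (∧-monotonic (sym p) (sym q))

  ∨-mono-≤ : ∀ {x x′ y y′} → x ≤ x′ → y ≤ y′ → x ∨ y ≤ x′ ∨ y′
  ∨-mono-≤ p q = sym (∨-monotonic (sym p) (sym q))

  x≤y⇒x∨y≡y : ∀ {x y} → x ≤ y → x ∨ y ≡ y
  x≤y⇒x∨y≡y p = x≤y⇒x∨y≈y (sym p)

module TenseCenteredKIProperties {a} (T : TenseCenteredKI a) where
  open TenseCenteredKI T
  open LS.IsDistributiveLattice isDistributiveLattice
    using (isLattice; ∧-comm; ∨-comm; ∨-assoc; ∨-distribʳ-∧)
  open LatticeOrder isLattice public hiding (_≤_)
  open ≡-Reasoning

  x≤𝟏 : ∀ x → x ≤ 𝟏
  x≤𝟏 = ∧-identity-𝟏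

  𝟏∧x≡x : ∀ x → 𝟏 ∧ x ≡ x
  𝟏∧x≡x x = trans (∧-comm 𝟏 x) (∧-identity-𝟏 x)

  ∼-∧ : ∀ x y → ∼ (x ∧ y) ≡ ∼ x ∨ ∼ y
  ∼-∧ x y = begin
    ∼ (x ∧ y)               ≡⟨ cong₂ (λ s t → ∼ (s ∧ t)) (∼-involutive x) (∼-involutive y) ⟨
    ∼ (∼ (∼ x) ∧ ∼ (∼ y))   ≡⟨ cong ∼ (∼-deMorgan (∼ x) (∼ y)) ⟨
    ∼ (∼ (∼ x ∨ ∼ y))       ≡⟨ ∼-involutive _ ⟩
    ∼ x ∨ ∼ y               ∎

  ∼-antitone : ∀ {x y} → x ≤ y → ∼ y ≤ ∼ x
  ∼-antitone {x} {y} x≤y =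
    trans (sym (∼-deMorgan y x)) (cong ∼ (trans (∨-comm y x) (x≤y⇒x∨y≡y x≤y)))

  x∧∼x≤c : ∀ x → x ∧ ∼ x ≤ c
  x∧∼x≤c x = subst (x ∧ ∼ x ≤_) (trans (cong (c ∨_) ∼c) (∨-idem c)) (kleene x c)

  ⇒-monoʳ-≤ : ∀ {x y z} → y ≤ z → x ⇒ y ≤ x ⇒ z
  ⇒-monoʳ-≤ {x} {y} {z} y≤z = trans (⇒-∧ x y z) (cong (x ⇒_) y≤z)

  ⇒-antiˡ-≤ : ∀ {x y z} → x ≤ y → y ⇒ z ≤ x ⇒ z
  ⇒-antiˡ-≤ {x} {y} {z} x≤y =
    trans (∧-comm (y ⇒ z) (x ⇒ z)) (trans (⇒-∨ x y z) (cong (_⇒ z) (x≤y⇒x∨y≡y x≤y)))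

  c≤⇒ : ∀ {x y} → c ≤ y → c ≤ x ⇒ y
  c≤⇒ {x} {y} c≤y = begin
    c ∧ (x ⇒ y)        ≡⟨ ∧-comm c _ ⟩
    (x ⇒ y) ∧ c        ≡⟨ ⇒-c x y ⟩
    (∼ x ∨ y) ∧ c      ≡⟨ ∧-comm _ c ⟩
    c ∧ (∼ x ∨ y)      ≡⟨ ≤-trans c≤y (y≤x∨y (∼ x) y) ⟩
    c                  ∎

  ⇒-elim : ∀ {x y} → c ≤ y → x ∧ (x ⇒ y) ≤ y
  ⇒-elim {x} {y} c≤y =
    ≤-trans (x≤x∨y _ c) (subst (_ ∨ c ≤_) (trans (∨-comm y c) (x≤y⇒x∨y≡y c≤y)) (mp-c x y))

  𝟏⇒-elim : ∀ {y} → c ≤ y → 𝟏 ⇒ y ≤ y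
  𝟏⇒-elim {y} c≤y = subst (_≤ y) (𝟏∧x≡x _) (⇒-elim {𝟏} c≤y)

  c⇒≡𝟏 : ∀ {d} → c ≤ d → c ⇒ d ≡ 𝟏
  c⇒≡𝟏 c≤d = ≤-antisym (x≤𝟏 _) (subst (_≤ _) c⇒c (⇒-monoʳ-≤ c≤d))

  ∨c⇒ : ∀ x {d} → c ≤ d → (x ∨ c) ⇒ d ≡ x ⇒ d
  ∨c⇒ x {d} c≤d = begin
    (x ∨ c) ⇒ d          ≡⟨ ⇒-∨ x c d ⟨
    (x ⇒ d) ∧ (c ⇒ d)    ≡⟨ cong ((x ⇒ d) ∧_) (c⇒≡𝟏 c≤d) ⟩
    (x ⇒ d) ∧ 𝟏          ≡⟨ ∧-identity-𝟏 _ ⟩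
    x ⇒ d                ∎

  infix 9 _⁺ _⁻
  _⁺ _⁻ : Carrier → Carrier
  x ⁺ = x ∨ c
  x ⁻ = ∼ x ∨ c

  c≤⁺ : ∀ x → c ≤ x ⁺
  c≤⁺ x = y≤x∨y x c

  c≤⁻ : ∀ x → c ≤ x ⁻
  c≤⁻ x = c≤⁺ (∼ x)

  𝟏⁺ : 𝟏 ⁺ ≡ 𝟏
  𝟏⁺ = trans (∨-comm 𝟏 c) (x≤y⇒x∨y≡y (x≤𝟏 c))

  𝟏⁻ : 𝟏 ⁻ ≡ c
  𝟏⁻ = x≤y⇒x∨y≡y (subst (∼ 𝟏 ≤_) ∼c (∼-antitone (x≤𝟏 c)))

  ∼[x⁻] : ∀ x → ∼ (x ⁻) ≡ x ∧ c
  ∼[x⁻] x = trans (∼-deMorgan (∼ x) c) (cong₂ _∧_ (∼-involutive x) ∼c)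

  x⁻∧x⁺≤c : ∀ x → x ⁻ ∧ x ⁺ ≤ c
  x⁻∧x⁺≤c x = subst (_≤ c) (∨-distribʳ-∧ c (∼ x) x)
    (∨-least (subst (_≤ c) (∧-comm x (∼ x)) (x∧∼x≤c x)) ≤-refl)

  ⁺-∧ : ∀ x y → (x ∧ y) ⁺ ≡ x ⁺ ∧ y ⁺
  ⁺-∧ x y = ∨-distribʳ-∧ c x y

  ⁻-∨ : ∀ x y → (x ∨ y) ⁻ ≡ x ⁻ ∧ y ⁻
  ⁻-∨ x y = trans (cong (_∨ c) (∼-deMorgan x y)) (⁺-∧ (∼ x) (∼ y))

  ⁺-∨ : ∀ x y → (x ∨ y) ⁺ ≡ x ⁺ ∨ y ⁺
  ⁺-∨ x y = begin
    (x ∨ y) ∨ c          ≡⟨ ∨-assoc x y c ⟩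
    x ∨ (y ∨ c)          ≡⟨ cong (λ t → x ∨ (y ∨ t)) (∨-idem c) ⟨
    x ∨ (y ∨ (c ∨ c))    ≡⟨ cong (x ∨_) (∨-assoc y c c) ⟨
    x ∨ ((y ∨ c) ∨ c)    ≡⟨ cong (x ∨_) (∨-comm (y ∨ c) c) ⟩
    x ∨ (c ∨ (y ∨ c))    ≡⟨ ∨-assoc x c (y ∨ c) ⟨
    (x ∨ c) ∨ (y ∨ c)    ∎

  ⁻-∧ : ∀ x y → (x ∧ y) ⁻ ≡ x ⁻ ∨ y ⁻
  ⁻-∧ x y = trans (cong (_∨ c) (∼-∧ x y)) (⁺-∨ (∼ x) (∼ y))

  ⁻-∼ : ∀ x → (∼ x) ⁻ ≡ x ⁺
  ⁻-∼ x = cong (_∨ c) (∼-involutive x)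

  ⁺-⇒ : ∀ x y → (x ⇒ y) ⁺ ≡ (x ⁺ ⇒ y ⁺) ∧ (y ⁻ ⇒ x ⁻)
  ⁺-⇒ x y = begin
    (x ⇒ y) ∨ c                              ≡⟨ cong (λ t → (x ⇒ t) ∨ c) (∼-involutive y) ⟨
    (x ⇒ ∼ (∼ y)) ∨ c                        ≡⟨ ⇒-∼ x (∼ y) ⟩
    (x ⇒ (∼ (∼ y) ∨ c)) ∧ (∼ y ⇒ x ⁻)        ≡⟨ cong (λ t → (x ⇒ t) ∧ (∼ y ⇒ x ⁻)) (⁻-∼ y) ⟩
    (x ⇒ y ⁺) ∧ (∼ y ⇒ x ⁻)                  ≡⟨ cong₂ _∧_ (∨c⇒ x (c≤⁺ y)) (∨c⇒ (∼ y) (c≤⁻ x)) ⟨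
    (x ⁺ ⇒ y ⁺) ∧ (y ⁻ ⇒ x ⁻)                ∎

  ⁻-⇒ : ∀ x y → (x ⇒ y) ⁻ ≡ x ⁺ ∧ y ⁻
  ⁻-⇒ x y = begin
    ∼ (x ⇒ y) ∨ c            ≡⟨ cong (∼ (x ⇒ y) ∨_) ∼c ⟨
    ∼ (x ⇒ y) ∨ ∼ c          ≡⟨ ∼-∧ (x ⇒ y) c ⟨
    ∼ ((x ⇒ y) ∧ c)          ≡⟨ cong ∼ (⇒-c x y) ⟩
    ∼ ((∼ x ∨ y) ∧ c)        ≡⟨ ∼-∧ (∼ x ∨ y) c ⟩
    ∼ (∼ x ∨ y) ∨ ∼ c        ≡⟨ cong₂ _∨_ (∼-deMorgan (∼ x) y) ∼c ⟩
    (∼ (∼ x) ∧ ∼ y) ∨ c      ≡⟨ cong (λ t → (t ∧ ∼ y) ∨ c) (∼-involutive x) ⟩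
    (x ∧ ∼ y) ∨ c            ≡⟨ ⁺-∧ x (∼ y) ⟩
    x ⁺ ∧ y ⁻                ∎

  module TenseOperator (K : Carrier → Carrier)
                       (K-∧ : ∀ x y → K (x ∧ y) ≡ K x ∧ K y)
                       (Kc : K c ≡ c)
                       (K-∨ : ∀ x y → K (x ∨ y) ≤ K x ∨ ∼ (K (∼ y))) where

    K-mono : ∀ {x y} → x ≤ y → K x ≤ K y
    K-mono {x} {y} x≤y = trans (sym (K-∧ x y)) (cong K x≤y)

    c≤K : ∀ {x} → c ≤ x → c ≤ K x
    c≤K {x} c≤x = subst (_≤ K x) Kc (K-mono c≤x)

    ⁺-K : ∀ x → (K x) ⁺ ≡ K (x ⁺)
    ⁺-K x = ≤-antisym
      (∨-least (K-mono (x≤x∨y x c)) (subst (_≤ K (x ⁺)) Kc (K-mono (c≤⁺ x))))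
      (subst (λ t → K (x ⁺) ≤ K x ∨ t) ∼K∼c≡c (K-∨ x c))
      where
        ∼K∼c≡c : ∼ (K (∼ c)) ≡ c
        ∼K∼c≡c = trans (cong (λ t → ∼ (K t)) ∼c) (trans (cong ∼ Kc) ∼c)

    ⁻-K : ∀ x → (K x) ⁻ ≡ ∼ (K (∼ (x ⁻)))
    ⁻-K x = begin
      ∼ (K x) ∨ c           ≡⟨ cong (∼ (K x) ∨_) ∼c ⟨
      ∼ (K x) ∨ ∼ c         ≡⟨ ∼-∧ (K x) c ⟨
      ∼ (K x ∧ c)           ≡⟨ cong (λ t → ∼ (K x ∧ t)) Kc ⟨
      ∼ (K x ∧ K c)         ≡⟨ cong ∼ (K-∧ x c) ⟨
      ∼ (K (x ∧ c))         ≡⟨ cong (λ t → ∼ (K t)) (∼[x⁻] x) ⟨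
      ∼ (K (∼ (x ⁻)))       ∎

  module G = TenseOperator G G-∧ Gc G-∨
  module H = TenseOperator H H-∧ Hc H-∨

module _ {a} (U : ItKIc1 a) where
  open ItKIc1 U
  open TenseCenteredKIProperties tkI
  open LS.IsDistributiveLattice isDistributiveLattice
    using (∧-comm; ∨-comm; ∧-assoc; ∧-absorbs-∨; ∧-distribˡ-∨; ∧-distribʳ-∨)

  x≤y⇒[x⇒y≡𝟏] : ∀ {x y} → x ≤ y → x ⇒ y ≡ 𝟏
  x≤y⇒[x⇒y≡𝟏] {x} x≤y = ≤-antisym (x≤𝟏 _) (subst (_≤ _) (⇒-refl x) (⇒-monoʳ-≤ x≤y))

  Interderivable : ∀ {ℓ} → Pred Carrier ℓ → Rel Carrier ℓ
  Interderivable D x y = (x ⇒ y) ∈ D × (y ⇒ x) ∈ D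

  congruenceOf : ∀ {ℓ} → Pred Carrier ℓ → Rel Carrier ℓ
  congruenceOf D x y = Interderivable D (x ⁺) (y ⁺) × Interderivable D (x ⁻) (y ⁻)

  oneClass : ∀ {ℓ} → Rel Carrier ℓ → Pred Carrier ℓ
  oneClass θ x = θ x 𝟏

  congruenceOf-mono : ∀ {ℓ} {D E : Pred Carrier ℓ} → D ⊆ E →
                      ∀ {x y} → congruenceOf D x y → congruenceOf E x y
  congruenceOf-mono D⊆E ((p , p′) , (q , q′)) = (D⊆E p , D⊆E p′) , (D⊆E q , D⊆E q′)

  module _ {ℓ} {D : Pred Carrier ℓ} (isTenseDS : IsTenseDS U D) where
    open IsTenseDS isTenseDS

    ⇒∈-of-≤ : ∀ {x y} → x ≤ y → (x ⇒ y) ∈ D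
    ⇒∈-of-≤ x≤y = subst (_∈ D) (sym (x≤y⇒[x⇒y≡𝟏] x≤y)) 𝟏∈

    ∈-upward : ∀ {x y} → x ∈ D → x ≤ y → y ∈ D
    ∈-upward x∈D x≤y = mp x∈D (⇒∈-of-≤ x≤y)

    ↔-G : ∀ {x y} → Interderivable D x y → Interderivable D (G x) (G y)
    ↔-G {x} {y} (p , p′) = ∈-upward (G-closed p) (G-⇒ x y) , ∈-upward (G-closed p′) (G-⇒ y x)

    ↔-F : ∀ {x y} → Interderivable D x y → Interderivable D (F x) (F y)
    ↔-F {x} {y} (p , p′) = ∈-upward (G-closed p) (G-⇒F x y) , ∈-upward (G-closed p′) (G-⇒F y x)

    ↔-H : ∀ {x y} → Interderivable D x y → Interderivable D (H x) (H y)
    ↔-H {x} {y} (p , p′) = ∈-upward (H-closed p) (H-⇒ x y) , ∈-upward (H-closed p′) (H-⇒ y x)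

    ↔-P : ∀ {x y} → Interderivable D x y → Interderivable D (P x) (P y)
    ↔-P {x} {y} (p , p′) = ∈-upward (H-closed p) (H-⇒P x y) , ∈-upward (H-closed p′) (H-⇒P y x)

    module _ (filter : IsTense1Filter U (λ x → x ∈ D × x ∈ C U)) where
      private module Filter = IsTense1Filter filter

      ∧-∈ : ∀ {x y} → c ≤ x → c ≤ y → x ∈ D → y ∈ D → (x ∧ y) ∈ D
      ∧-∈ c≤x c≤y x∈D y∈D = proj₁ (Filter.∧-closed (x∈D , c≤x) (y∈D , c≤y))

      ⇒-intro : ∀ {x y f} → c ≤ x → c ≤ y → c ≤ f → f ∈ D → x ∧ f ≤ y → (x ⇒ y) ∈ D
      ⇒-intro {x} {y} c≤x c≤y c≤f f∈D x∧f≤y = ∈-upward 𝟏⇒[x⇒y]∈D (𝟏⇒-elim (c≤⇒ c≤y))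
        where
          𝟏⇒[x⇒y]∈D : (𝟏 ⇒ (x ⇒ y)) ∈ D
          𝟏⇒[x⇒y]∈D = subst (λ t → (t ⇒ (x ⇒ y)) ∈ D) (x≤y⇒[x⇒y≡𝟏] x∧f≤y)
                        (proj₁ (Filter.one c≤x c≤y (f∈D , c≤f)))

      ⇒∈-trans : ∀ {x y z} → c ≤ x → c ≤ y → c ≤ z →
                 (x ⇒ y) ∈ D → (y ⇒ z) ∈ D → (x ⇒ z) ∈ D
      ⇒∈-trans {x} {y} {z} c≤x c≤y c≤z p q =
        ⇒-intro c≤x c≤z (∧-greatest (c≤⇒ c≤y) (c≤⇒ c≤z)) (∧-∈ (c≤⇒ c≤y) (c≤⇒ c≤z) p q)
          (≤-trans (≤-reflexive (sym (∧-assoc x (x ⇒ y) (y ⇒ z))))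
                   (≤-trans (∧-mono-≤ (⇒-elim c≤y) ≤-refl) (⇒-elim c≤z)))

      ⇒∈-∧ : ∀ {x x′ y y′} → c ≤ x → c ≤ x′ → c ≤ y → c ≤ y′ →
             (x ⇒ x′) ∈ D → (y ⇒ y′) ∈ D → (x ∧ y ⇒ x′ ∧ y′) ∈ D
      ⇒∈-∧ {x} {x′} {y} {y′} c≤x c≤x′ c≤y c≤y′ p q =
        ⇒-intro (∧-greatest c≤x c≤y) (∧-greatest c≤x′ c≤y′)
          (∧-greatest (c≤⇒ c≤x′) (c≤⇒ c≤y′)) (∧-∈ (c≤⇒ c≤x′) (c≤⇒ c≤y′) p q)
          (∧-greatest
            (≤-trans (∧-mono-≤ (x∧y≤x x y) (x∧y≤x (x ⇒ x′) (y ⇒ y′))) (⇒-elim c≤x′))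
            (≤-trans (∧-mono-≤ (x∧y≤y x y) (x∧y≤y (x ⇒ x′) (y ⇒ y′))) (⇒-elim c≤y′)))

      ⇒∈-∨ : ∀ {x x′ y y′} → c ≤ x → c ≤ x′ → c ≤ y → c ≤ y′ →
             (x ⇒ x′) ∈ D → (y ⇒ y′) ∈ D → (x ∨ y ⇒ x′ ∨ y′) ∈ D
      ⇒∈-∨ {x} {x′} {y} {y′} c≤x c≤x′ c≤y c≤y′ p q =
        ⇒-intro (≤-trans c≤x (x≤x∨y x y)) (≤-trans c≤x′ (x≤x∨y x′ y′))
          (∧-greatest (c≤⇒ c≤x′) (c≤⇒ c≤y′)) (∧-∈ (c≤⇒ c≤x′) (c≤⇒ c≤y′) p q)
          (subst (_≤ x′ ∨ y′) (sym (∧-distribʳ-∨ _ x y))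
            (∨-mono-≤ (≤-trans (∧-mono-≤ ≤-refl (x∧y≤x (x ⇒ x′) (y ⇒ y′))) (⇒-elim c≤x′))
                      (≤-trans (∧-mono-≤ ≤-refl (x∧y≤y (x ⇒ x′) (y ⇒ y′))) (⇒-elim c≤y′))))

      ⇒∈-⇒ˡ : ∀ {x x′ y} → c ≤ x → c ≤ x′ → c ≤ y →
              (x′ ⇒ x) ∈ D → ((x ⇒ y) ⇒ (x′ ⇒ y)) ∈ D
      ⇒∈-⇒ˡ {x} {x′} {y} c≤x c≤x′ c≤y p =
        ⇒-intro (c≤⇒ c≤y) (c≤⇒ c≤y) (c≤⇒ (c≤⇒ c≤y)) f∈D
          (≤-trans (∧-mono-≤ (⇒-antiˡ-≤ (⇒-elim c≤x)) ≤-refl) (⇒-elim (c≤⇒ c≤y)))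
        where
          f∈D : (((x′ ∧ (x′ ⇒ x)) ⇒ y) ⇒ (x′ ⇒ y)) ∈ D
          f∈D = proj₁ (Filter.one c≤x′ c≤y (p , c≤⇒ c≤x))

      ⇒∈-⇒ʳ : ∀ {x y y′} → c ≤ x → c ≤ y → c ≤ y′ →
              (y ⇒ y′) ∈ D → ((x ⇒ y) ⇒ (x ⇒ y′)) ∈ D
      ⇒∈-⇒ʳ {x} {y} {y′} c≤x c≤y c≤y′ p =
        ⇒-intro (c≤⇒ c≤y) (c≤⇒ c≤y′) (c≤⇒ (c≤⇒ c≤y′)) x⇒[y⇒y′]∈D
          (subst (_≤ x ⇒ y′) (sym (⇒-∧ x y (y ⇒ y′))) (⇒-monoʳ-≤ (⇒-elim c≤y′)))
        where
          x⇒[y⇒y′]∈D : (x ⇒ (y ⇒ y′)) ∈ D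
          x⇒[y⇒y′]∈D = ⇒-intro c≤x (c≤⇒ c≤y′) (c≤⇒ c≤y′) p (x∧y≤y x _)

      ⇒∈-⇒ : ∀ {x x′ y y′} → c ≤ x → c ≤ x′ → c ≤ y → c ≤ y′ →
             (x′ ⇒ x) ∈ D → (y ⇒ y′) ∈ D → ((x ⇒ y) ⇒ (x′ ⇒ y′)) ∈ D
      ⇒∈-⇒ c≤x c≤x′ c≤y c≤y′ p q =
        ⇒∈-trans (c≤⇒ c≤y) (c≤⇒ c≤y) (c≤⇒ c≤y′) (⇒∈-⇒ˡ c≤x c≤x′ c≤y p) (⇒∈-⇒ʳ c≤x′ c≤y c≤y′ q)

      ↔-trans : ∀ {x y z} → c ≤ x → c ≤ y → c ≤ z →
                Interderivable D x y → Interderivable D y z → Interderivable D x z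
      ↔-trans c≤x c≤y c≤z (p , p′) (q , q′) =
        ⇒∈-trans c≤x c≤y c≤z p q , ⇒∈-trans c≤z c≤y c≤x q′ p′

      ↔-∧ : ∀ {x x′ y y′} → c ≤ x → c ≤ x′ → c ≤ y → c ≤ y′ →
            Interderivable D x x′ → Interderivable D y y′ → Interderivable D (x ∧ y) (x′ ∧ y′)
      ↔-∧ c≤x c≤x′ c≤y c≤y′ (p , p′) (q , q′) =
        ⇒∈-∧ c≤x c≤x′ c≤y c≤y′ p q , ⇒∈-∧ c≤x′ c≤x c≤y′ c≤y p′ q′

      ↔-∨ : ∀ {x x′ y y′} → c ≤ x → c ≤ x′ → c ≤ y → c ≤ y′ →
            Interderivable D x x′ → Interderivable D y y′ → Interderivable D (x ∨ y) (x′ ∨ y′)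
      ↔-∨ c≤x c≤x′ c≤y c≤y′ (p , p′) (q , q′) =
        ⇒∈-∨ c≤x c≤x′ c≤y c≤y′ p q , ⇒∈-∨ c≤x′ c≤x c≤y′ c≤y p′ q′

      ↔-⇒ : ∀ {x x′ y y′} → c ≤ x → c ≤ x′ → c ≤ y → c ≤ y′ →
            Interderivable D x x′ → Interderivable D y y′ → Interderivable D (x ⇒ y) (x′ ⇒ y′)
      ↔-⇒ c≤x c≤x′ c≤y c≤y′ (p , p′) (q , q′) =
        ⇒∈-⇒ c≤x c≤x′ c≤y c≤y′ p′ q , ⇒∈-⇒ c≤x′ c≤x c≤y′ c≤y p q′

      isCongruence-congruenceOf : IsCongruence U (congruenceOf D)
      isCongruence-congruenceOf = record
        { isEquivalence = record
            { refl  = ↔-refl , ↔-refl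
            ; sym   = λ ((p , p′) , (q , q′)) → (p′ , p) , (q′ , q)
            ; trans = λ {x} {y} {z} (p , q) (p′ , q′) →
                ↔-trans (c≤⁺ x) (c≤⁺ y) (c≤⁺ z) p p′ , ↔-trans (c≤⁻ x) (c≤⁻ y) (c≤⁻ z) q q′
            }
        ; ∧-cong = λ {x} {x′} {y} {y′} (p , p′) (q , q′) →
            along (⁺-∧ x y) (⁺-∧ x′ y′) (↔-∧ (c≤⁺ x) (c≤⁺ x′) (c≤⁺ y) (c≤⁺ y′) p q) ,
            along (⁻-∧ x y) (⁻-∧ x′ y′) (↔-∨ (c≤⁻ x) (c≤⁻ x′) (c≤⁻ y) (c≤⁻ y′) p′ q′)
        ; ∨-cong = λ {x} {x′} {y} {y′} (p , p′) (q , q′) →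
            along (⁺-∨ x y) (⁺-∨ x′ y′) (↔-∨ (c≤⁺ x) (c≤⁺ x′) (c≤⁺ y) (c≤⁺ y′) p q) ,
            along (⁻-∨ x y) (⁻-∨ x′ y′) (↔-∧ (c≤⁻ x) (c≤⁻ x′) (c≤⁻ y) (c≤⁻ y′) p′ q′)
        ; ⇒-cong = λ {x} {x′} {y} {y′} (p , p′) (q , q′) →
            along (⁺-⇒ x y) (⁺-⇒ x′ y′)
              (↔-∧ (c≤⇒ (c≤⁺ y)) (c≤⇒ (c≤⁺ y′)) (c≤⇒ (c≤⁻ x)) (c≤⇒ (c≤⁻ x′))
                (↔-⇒ (c≤⁺ x) (c≤⁺ x′) (c≤⁺ y) (c≤⁺ y′) p q)
                (↔-⇒ (c≤⁻ y) (c≤⁻ y′) (c≤⁻ x) (c≤⁻ x′) q′ p′)) ,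
            along (⁻-⇒ x y) (⁻-⇒ x′ y′) (↔-∧ (c≤⁺ x) (c≤⁺ x′) (c≤⁻ y) (c≤⁻ y′) p q′)
        ; ∼-cong = λ {x} {x′} (p , p′) → p′ , along (⁻-∼ x) (⁻-∼ x′) p
        ; G-cong = λ {x} {x′} (p , p′) →
            along (G.⁺-K x) (G.⁺-K x′) (↔-G p) , along (G.⁻-K x) (G.⁻-K x′) (↔-F p′)
        ; H-cong = λ {x} {x′} (p , p′) →
            along (H.⁺-K x) (H.⁺-K x′) (↔-H p) , along (H.⁻-K x) (H.⁻-K x′) (↔-P p′)
        }
        where
          ↔-refl : ∀ {x} → Interderivable D x x
          ↔-refl = ⇒∈-of-≤ ≤-refl , ⇒∈-of-≤ ≤-refl
          along : ∀ {s s′ t t′} → s ≡ t → s′ ≡ t′ → Interderivable D t t′ → Interderivable D s s′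
          along s≡t s′≡t′ = subst₂ (Interderivable D) (sym s≡t) (sym s′≡t′)

  module _ {ℓ} {D : Pred Carrier ℓ} (isD : IsCenteredTenseDS U D) where
    open IsCenteredTenseDS isD

    oneClass-congruenceOf⊆ : oneClass (congruenceOf D) ⊆ D
    oneClass-congruenceOf⊆ {x} ((_ , 𝟏⁺⇒x⁺) , (x⁻⇒𝟏⁻ , _)) =
      centered x (subst (_∈ D) x⁻⇒𝟏⁻≡∼x⇒c x⁻⇒𝟏⁻) (subst (λ t → (t ⇒ x ⁺) ∈ D) 𝟏⁺ 𝟏⁺⇒x⁺)
      where
        x⁻⇒𝟏⁻≡∼x⇒c : x ⁻ ⇒ 𝟏 ⁻ ≡ ∼ x ⇒ c
        x⁻⇒𝟏⁻≡∼x⇒c = trans (cong (x ⁻ ⇒_) 𝟏⁻) (∨c⇒ (∼ x) ≤-refl)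

    ⊆oneClass-congruenceOf : D ⊆ oneClass (congruenceOf D)
    ⊆oneClass-congruenceOf {x} x∈D = (x⁺⇒𝟏⁺ , 𝟏⁺⇒x⁺) , (x⁻⇒𝟏⁻ , 𝟏⁻⇒x⁻)
      where
        x⁺∈D : x ⁺ ∈ D
        x⁺∈D = ∈-upward isTenseDS x∈D (x≤x∨y x c)
        x⁺⇒𝟏⁺ : (x ⁺ ⇒ 𝟏 ⁺) ∈ D
        x⁺⇒𝟏⁺ = ⇒∈-of-≤ isTenseDS (∨-mono-≤ (x≤𝟏 x) ≤-refl)
        𝟏⁺⇒x⁺ : (𝟏 ⁺ ⇒ x ⁺) ∈ D
        𝟏⁺⇒x⁺ = ⇒-intro isTenseDS filter (c≤⁺ 𝟏) (c≤⁺ x) (c≤⁺ x) x⁺∈D (x∧y≤y _ _)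
        x⁻⇒𝟏⁻ : (x ⁻ ⇒ 𝟏 ⁻) ∈ D
        x⁻⇒𝟏⁻ = subst (λ t → (x ⁻ ⇒ t) ∈ D) (sym 𝟏⁻)
                  (⇒-intro isTenseDS filter (c≤⁻ x) ≤-refl (c≤⁺ x) x⁺∈D (x⁻∧x⁺≤c x))
        𝟏⁻⇒x⁻ : (𝟏 ⁻ ⇒ x ⁻) ∈ D
        𝟏⁻⇒x⁻ = ⇒∈-of-≤ isTenseDS (∨-mono-≤ (∼-antitone (x≤𝟏 x)) ≤-refl)

  module _ {ℓ} {θ : Rel Carrier ℓ} (isθ : IsCongruence U θ) where
    open IsCongruence isθ
    private
      module θ = IsEquivalence isEquivalence
      θ-setoid : Setoid a ℓ
      θ-setoid = record { isEquivalence = isEquivalence }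
    open SetoidReasoning θ-setoid

    θ-from-⇒ : ∀ {x y} → c ≤ x → c ≤ y → θ (x ⇒ y) 𝟏 → θ (y ⇒ x) 𝟏 → θ x y
    θ-from-⇒ {x} {y} c≤x c≤y p q = begin
      x         ≈⟨ θ-∧ c≤y p ⟩
      x ∧ y     ≡⟨ ∧-comm x y ⟩
      y ∧ x     ≈⟨ θ-∧ c≤x q ⟨
      y         ∎
      where
        θ-∧ : ∀ {u v} → c ≤ v → θ (u ⇒ v) 𝟏 → θ u (u ∧ v)
        θ-∧ {u} {v} c≤v u⇒v = begin
          u                     ≡⟨ ∧-identity-𝟏 u ⟨
          u ∧ 𝟏                 ≈⟨ ∧-cong θ.refl u⇒v ⟨
          u ∧ (u ⇒ v)           ≡⟨ ⇒-elim c≤v ⟨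
          (u ∧ (u ⇒ v)) ∧ v     ≈⟨ ∧-cong (∧-cong θ.refl u⇒v) θ.refl ⟩
          (u ∧ 𝟏) ∧ v           ≡⟨ cong (_∧ v) (∧-identity-𝟏 u) ⟩
          u ∧ v                 ∎

    -- The pair (x ⁺ , x ⁻) determines x, because x = x ∧ x ⁺ and x ∧ c = ∼ (x ⁻).
    θ-from-components : ∀ {x y} → θ (x ⁺) (y ⁺) → θ (x ⁻) (y ⁻) → θ x y
    θ-from-components {x} {y} p q = begin
      x                     ≡⟨ ∧-absorbs-∨ x c ⟨
      x ∧ x ⁺               ≈⟨ ∧-cong θ.refl p ⟩
      x ∧ y ⁺               ≡⟨ ∧-distribˡ-∨ x y c ⟩
      (x ∧ y) ∨ (x ∧ c)     ≈⟨ ∨-cong θ.refl x∧c≈y∧c ⟩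
      (x ∧ y) ∨ (y ∧ c)     ≡⟨ cong (_∨ (y ∧ c)) (∧-comm x y) ⟩
      (y ∧ x) ∨ (y ∧ c)     ≡⟨ ∧-distribˡ-∨ y x c ⟨
      y ∧ x ⁺               ≈⟨ ∧-cong θ.refl p ⟩
      y ∧ y ⁺               ≡⟨ ∧-absorbs-∨ y c ⟩
      y                     ∎
      where
        x∧c≈y∧c : θ (x ∧ c) (y ∧ c)
        x∧c≈y∧c = begin
          x ∧ c          ≡⟨ ∼[x⁻] x ⟨
          ∼ (x ⁻)        ≈⟨ ∼-cong q ⟩
          ∼ (y ⁻)        ≡⟨ ∼[x⁻] y ⟩
          y ∧ c          ∎

    oneClass-from-components : ∀ {x} → θ (x ⁺) 𝟏 → θ (x ⁻) c → θ x 𝟏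
    oneClass-from-components p q =
      θ-from-components (θ.trans p (θ.reflexive (sym 𝟏⁺))) (θ.trans q (θ.reflexive (sym 𝟏⁻)))

    oneClass-upward : ∀ {x y} → θ x 𝟏 → x ≤ y → θ y 𝟏
    oneClass-upward {x} {y} p x≤y = begin
      y        ≡⟨ x≤y⇒x∨y≡y x≤y ⟨
      x ∨ y    ≈⟨ ∨-cong p θ.refl ⟩
      𝟏 ∨ y    ≡⟨ ∨-comm 𝟏 y ⟩
      y ∨ 𝟏    ≡⟨ x≤y⇒x∨y≡y (x≤𝟏 y) ⟩
      𝟏        ∎

    oneClass-𝟏⇒ : ∀ {v} → θ (𝟏 ⇒ v) 𝟏 → θ v 𝟏
    oneClass-𝟏⇒ {v} p = oneClass-from-components v⁺≈𝟏 v⁻≈c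
      where
        v⁺≈𝟏 : θ (v ⁺) 𝟏
        v⁺≈𝟏 = oneClass-upward p
                 (≤-trans (x≤x∨y _ c) (subst (λ t → t ⁺ ≤ v ⁺) (𝟏∧x≡x _) (mp-c 𝟏 v)))
        v⁻≈c : θ (v ⁻) c
        v⁻≈c = begin
          v ⁻              ≡⟨ 𝟏∧x≡x (v ⁻) ⟨
          𝟏 ∧ v ⁻          ≡⟨ cong (_∧ v ⁻) 𝟏⁺ ⟨
          𝟏 ⁺ ∧ v ⁻        ≡⟨ ⁻-⇒ 𝟏 v ⟨
          (𝟏 ⇒ v) ⁻        ≈⟨ ∨-cong (∼-cong p) θ.refl ⟩
          𝟏 ⁻              ≡⟨ 𝟏⁻ ⟩
          c                ∎

    oneClass-mp : ∀ {u v} → θ u 𝟏 → θ (u ⇒ v) 𝟏 → θ v 𝟏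
    oneClass-mp u≈𝟏 u⇒v≈𝟏 = oneClass-𝟏⇒ (θ.trans (⇒-cong (θ.sym u≈𝟏) θ.refl) u⇒v≈𝟏)

    oneClass-one : ∀ {x y f} → θ f 𝟏 → θ (((x ∧ f) ⇒ y) ⇒ (x ⇒ y)) 𝟏
    oneClass-one {x} {y} {f} f≈𝟏 = begin
      ((x ∧ f) ⇒ y) ⇒ (x ⇒ y)    ≈⟨ ⇒-cong (⇒-cong (∧-cong θ.refl f≈𝟏) θ.refl) θ.refl ⟩
      ((x ∧ 𝟏) ⇒ y) ⇒ (x ⇒ y)    ≡⟨ cong (λ t → (t ⇒ y) ⇒ (x ⇒ y)) (∧-identity-𝟏 x) ⟩
      (x ⇒ y) ⇒ (x ⇒ y)          ≡⟨ ⇒-refl _ ⟩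
      𝟏                          ∎

    oneClass-centered : ∀ u → θ (∼ u ⇒ c) 𝟏 → θ (𝟏 ⇒ u ⁺) 𝟏 → θ u 𝟏
    oneClass-centered u ∼u⇒c≈𝟏 𝟏⇒u⁺≈𝟏 = oneClass-from-components (oneClass-𝟏⇒ 𝟏⇒u⁺≈𝟏) u⁻≈c
      where
        u⁻≈c : θ (u ⁻) c
        u⁻≈c = begin
          ∼ u ∨ c                   ≡⟨ cong (_∨ c) (∧-identity-𝟏 (∼ u)) ⟨
          (∼ u ∧ 𝟏) ∨ c             ≈⟨ ∨-cong (∧-cong θ.refl ∼u⇒c≈𝟏) θ.refl ⟨
          (∼ u ∧ (∼ u ⇒ c)) ∨ c     ≡⟨ x≤y⇒x∨y≡y (⇒-elim ≤-refl) ⟩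
          c                         ∎

    isCenteredTenseDS-oneClass : IsCenteredTenseDS U (oneClass θ)
    isCenteredTenseDS-oneClass = record
      { isTenseDS = record
          { 𝟏∈       = θ.refl
          ; mp       = oneClass-mp
          ; G-closed = λ p → θ.trans (G-cong p) (θ.reflexive G𝟏)
          ; H-closed = λ p → θ.trans (H-cong p) (θ.reflexive H𝟏)
          }
      ; filter = record
          { ⊆C       = proj₂
          ; 𝟏∈       = θ.refl , x≤𝟏 c
          ; up       = λ (p , _) c≤y x≤y → oneClass-upward p x≤y , c≤y
          ; ∧-closed = λ (p , c≤x) (q , c≤y) →
              θ.trans (∧-cong p q) (θ.reflexive (∧-identity-𝟏 𝟏)) , ∧-greatest c≤x c≤y
          ; one      = λ _ c≤y (p , _) → oneClass-one p , c≤⇒ (c≤⇒ c≤y)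
          ; G-closed = λ (p , c≤x) → θ.trans (G-cong p) (θ.reflexive G𝟏) , G.c≤K c≤x
          ; H-closed = λ (p , c≤x) → θ.trans (H-cong p) (θ.reflexive H𝟏) , H.c≤K c≤x
          }
      ; centered = oneClass-centered
      }

    congruenceOf-oneClass⊆ : ∀ {x y} → congruenceOf (oneClass θ) x y → θ x y
    congruenceOf-oneClass⊆ {x} {y} ((p , p′) , (q , q′)) =
      θ-from-components (θ-from-⇒ (c≤⁺ x) (c≤⁺ y) p p′) (θ-from-⇒ (c≤⁻ x) (c≤⁻ y) q q′)

    ⊆congruenceOf-oneClass : ∀ {x y} → θ x y → congruenceOf (oneClass θ) x y
    ⊆congruenceOf-oneClass {x} {y} x≈y =
      (⇒≈𝟏 x⁺≈y⁺ , ⇒≈𝟏 (θ.sym x⁺≈y⁺)) , (⇒≈𝟏 x⁻≈y⁻ , ⇒≈𝟏 (θ.sym x⁻≈y⁻))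
      where
        x⁺≈y⁺ : θ (x ⁺) (y ⁺)
        x⁺≈y⁺ = ∨-cong x≈y θ.refl
        x⁻≈y⁻ : θ (x ⁻) (y ⁻)
        x⁻≈y⁻ = ∨-cong (∼-cong x≈y) θ.refl
        ⇒≈𝟏 : ∀ {s t} → θ s t → θ (s ⇒ t) 𝟏
        ⇒≈𝟏 {t = t} s≈t = θ.trans (⇒-cong s≈t θ.refl) (θ.reflexive (⇒-refl t))

corollary7p13 : ∀ {a ℓ : Level} (U : ItKIc1 a) → CDS≅Con U ℓ
corollary7p13 U = record
  { to        = λ (D , isD) → congruenceOf U D ,
                  isCongruence-congruenceOf U (IsCenteredTenseDS.isTenseDS isD) (IsCenteredTenseDS.filter isD)
  ; from      = λ (θ , isθ) → oneClass U θ , isCenteredTenseDS-oneClass U isθ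
  ; to-mono   = λ {D} {E} → congruenceOf-mono U {D = proj₁ D} {proj₁ E}
  ; from-mono = λ θ⊆φ → θ⊆φ
  ; from∘to   = λ (_ , isD) → oneClass-congruenceOf⊆ U isD , ⊆oneClass-congruenceOf U isD
  ; to∘from   = λ (_ , isθ) → congruenceOf-oneClass⊆ U isθ , ⊆congruenceOf-oneClass U isθ
  }
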